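{- Let $n,m,r,t\ge 2$ be integers, let $\delta$ satisfy $1/n\le\delta\le 1/2$ and let $\varepsilon>0$. Let $G$ be an $r$-edge-coloured bipartite graph on vertex classes $A$ and $B$ with $|B|=n$. Let $\mathcal F=\{\mathcal H_1,\dots,\mathcal H_\ell\}$ be an $(r,t,m,\varepsilon)$-linked hub family for a non-empty set $X\subseteq A$ with $|X|\le\delta n$, and let $S_i$ be the core of $\mathcal H_i$. Suppose $\deg(v,\bigcup_{i\in[\ell]}S_i)\ge(1-\delta)n$ for each $v\in X$. Then the simplified graph $R(X,\mathcal F)$ has minimum degree at least $(1-6\delta)|V(R(X,\mathcal F))|$.
   Context: For an $r$-edge-coloured graph $G$ and $c\in[r]$, $G_c$ is the subgraph of colour-$c$ edges; $\deg(v,S)$ counts neighbours of $v$ in $S$, $\deg_c(v,S)$ counts those via colour-$c$ edges. Contracted graph: for bipartite $H$ with classes $A,B$ and $k\ge1$, $\tilde H(A,B,k)$ is the graph on $A$ where distinct $u,v$ are adjacent iff they have at least $k$ common neighbours in $B$; $\tilde G_c(T,B,k)$ is this for $G_c[T,B]$. Expanders: for $\varepsilon,s>0$, $x\ge s/2$, $\rho(x)=\varepsilon/\log^2(15x/s)$; $H$ is an $(\varepsilon,s)$-expander if every $U\subseteq V(H)$ with $s/2\le|U|\le|V(H)|/2$ has $|N_H(U)\setminus U|\ge\rho(|U|)|U|$. Connecting hub for $X\subseteq A$: a triple $(C,S,\mathcal T)$ with $C\subseteq[r]$, core $S\subseteq B$ with $|S|=m$, and routing sets $\mathcal T=\{T_c:c\in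 C\}$, pairwise disjoint subsets of $A\setminus X$ with $t\le|T_c|\le80rt$, such that (H1) each $\tilde G_c(T_c,B,m)$ is an $(\varepsilon,1)$-expander; (H2) $\deg_c(v,T_c)\ge|T_c|/(20r)$ for all $v\in S$, $c\in C$; (H3) every $v\in X$ has $\deg(v,S)\le|S|/2$ or $\deg_c(v,S)\ge|S|/(10r)$ for some $c\in C$. An $(r,t,m,\varepsilon)$-linked hub family for $X$ is a collection of such hubs $\mathcal H_i=(C_i,S_i,\mathcal T_i)$, $i\in[\ell]$, pairwise vertex-disjoint (cores pairwise disjoint, routing sets of different hubs disjoint), such that for all $1\le i<j\le\ell$, $c\in[r]$, the set $\{v\in X:\deg_c(v,S_i),\deg_c(v,S_j)\ge m/(10r)\}$ is empty or of size at least $t$. Simplified graph $R(X,\mathcal F)$: an $(r+1)$-edge-coloured graph on $X\cup\bigcup_i S_i$ in which $X$ is independent; $\bigcup_i S_i$ is complete with all edges coloured $r+1$; $v\in X$ with $\deg_G(v,S_i)\le m/2$ has no edges to $S_i$; and $v\in X$ with $\deg_G(v,S_i)>m/2$ is joined to every vertex of $S_i$ by edges of a single colour $c\in C_i$ with $\deg_c(v,S_i)\ge m/(10r)$ (any such fixed choice). Logarithms are natural.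
   Formalization: The parameters $\delta$ and $\varepsilon$ range over the rationals. -}

module Defs where

open import Data.Nat using (ℕ; zero; suc; _+_; _*_; _≤_; _≤?_)
open import Data.Fin using (Fin; zero; suc; _≟_; inject₁; fromℕ)
  renaming (_<_ to _<ᶠ_)
open import Data.Fin.Subset using (Subset; _∈_; _⊆_; _∩_; ∣_∣; Empty)
open import Data.Bool using (Bool; true; false; _∧_; _∨_; not)
open import Data.Maybe using (Maybe; just; nothing; is-just)
open import Data.Vec using (tabulate; lookup)
open import Data.Product using (Σ; _×_)
open import Data.Sum using (_⊎_)
open import Data.Empty renaming (⊥ to False)
open import Data.Unit using (⊤)
open import Relation.Nullary.Decidable using (⌊_⌋)
open import Relation.Binary.PropositionalEquality using (_≡_; _≢_)
open import Data.Integer using (+_)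
open import Data.Rational using (ℚ; 1ℚ; _/_)
  renaming (_+_ to _+q_; _*_ to _*q_; _-_ to _-q_; _≤_ to _≤q_)

ℕq : ℕ → ℚ
ℕq k = + k / 1

anyF : ∀ {k} → (Fin k → Bool) → Bool
anyF {zero}  f = false
anyF {suc k} f = f zero ∨ anyF (λ i → f (suc i))

colIs : ∀ {r} → Maybe (Fin r) → Fin r → Bool
colIs nothing  c = false
colIs (just d) c = ⌊ d ≟ c ⌋

-- r-edge-coloured bipartite graphs with classes A = Fin a, B = Fin n.
-- G v w = nothing : no edge between v ∈ A and w ∈ B;
-- G v w = just c  : an edge of colour c.

Colouring : ℕ → ℕ → ℕ → Set
Colouring a n r = Fin a → Fin n → Maybe (Fin r)

module _ {a n r : ℕ} (G : Colouring a n r) where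

  nbrB : Fin a → Subset n
  nbrB v = tabulate (λ w → is-just (G v w))

  nbrBc : Fin r → Fin a → Subset n
  nbrBc c v = tabulate (λ w → colIs (G v w) c)

  nbrAc : Fin r → Fin n → Subset a
  nbrAc c w = tabulate (λ u → colIs (G u w) c)

  deg : Fin a → Subset n → ℕ
  deg v S = ∣ nbrB v ∩ S ∣

  degc : Fin r → Fin a → Subset n → ℕ
  degc c v S = ∣ nbrBc c v ∩ S ∣

  degcB : Fin r → Fin n → Subset a → ℕ
  degcB c w T = ∣ nbrAc c w ∩ T ∣

  contrAdj : Fin r → ℕ → Fin a → Fin a → Bool
  contrAdj c k u v = not ⌊ u ≟ v ⌋ ∧ ⌊ k ≤? ∣ nbrBc c u ∩ nbrBc c v ∣ ⌋

  extNbr : Fin r → ℕ → Subset a → Subset a → Subset a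
  extNbr c k T U = tabulate (λ w →
    lookup T w ∧ not (lookup U w) ∧ anyF (λ u → lookup U u ∧ contrAdj c k u w))

-- Comparison  exp(√q) ≤ y  for rational q ≥ 0 and natural y, through the
-- exponential series: the partial sums up to degree 2K-1 of exp(√q) are
-- evenSum q K + √q · oddSum q K, where
--   evenSum q K = Σ_{j<K} q^j/(2j)!,   oddSum q K = Σ_{j<K} q^j/(2j+1)!,
-- and they increase to exp(√q).  Hence exp(√q) ≤ y iff for every K,
--   E_K ≤ y and q·O_K² ≤ (y − E_K)².

evenTerm : ℚ → ℕ → ℚ
evenTerm q zero    = 1ℚ
evenTerm q (suc j) =
  evenTerm q j *q q *q (+ 1 / suc (2 * j)) *q (+ 1 / suc (suc (2 * j)))

oddTerm : ℚ → ℕ → ℚ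
oddTerm q j = evenTerm q j *q (+ 1 / suc (2 * j))

sumBelow : (ℕ → ℚ) → ℕ → ℚ
sumBelow f zero    = + 0 / 1
sumBelow f (suc K) = sumBelow f K +q f K

evenSum oddSum : ℚ → ℕ → ℚ
evenSum q = sumBelow (evenTerm q)
oddSum  q = sumBelow (oddTerm q)

ExpSqrtLe : ℚ → ℕ → Set
ExpSqrtLe q y = ∀ K →
  (evenSum q K ≤q ℕq y) ×
  (q *q oddSum q K *q oddSum q K ≤q (ℕq y -q evenSum q K) *q (ℕq y -q evenSum q K))

-- RhoBound ε u N  expresses  ρ(u)·u ≤ N  with s = 1, i.e.
--   ε·u / log²(15u) ≤ N,
-- for ε > 0 and u ≥ 1 (so log(15u) > 0).  For N = 0 this is false
-- (the left side is positive); for N > 0 it is equivalent to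
--   √(ε·u/N) ≤ log(15u),  i.e.  exp(√(ε·u/N)) ≤ 15u.
RhoBound : ℚ → ℕ → ℕ → Set
RhoBound ε u zero    = False
RhoBound ε u (suc k) = ExpSqrtLe (ε *q ℕq u *q (+ 1 / suc k)) (15 * u)

IsContrExpander : ∀ {a n r} → Colouring a n r → Fin r → ℕ → ℚ → Subset a → Set
IsContrExpander {a} G c k ε T =
  ∀ (U : Subset a) → U ⊆ T → 1 ≤ ∣ U ∣ → 2 * ∣ U ∣ ≤ ∣ T ∣ →
  RhoBound ε ∣ U ∣ ∣ extNbr G c k T U ∣

-- Connecting hubs  (C, S, T)  for X ⊆ A, with parameters r,t,m,ε.
-- T c is the routing set T_c (only meaningful for c ∈ C).

record Hub {a n r : ℕ} (G : Colouring a n r) (X : Subset a) (t m : ℕ) (ε : ℚ) : Set where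
  field
    C : Subset r
    S : Subset n
    T : Fin r → Subset a
    core-size    : ∣ S ∣ ≡ m
    T-avoids-X   : ∀ c → c ∈ C → Empty (T c ∩ X)
    T-disjoint   : ∀ c c′ → c ∈ C → c′ ∈ C → c ≢ c′ → Empty (T c ∩ T c′)
    T-lower      : ∀ c → c ∈ C → t ≤ ∣ T c ∣
    T-upper      : ∀ c → c ∈ C → ∣ T c ∣ ≤ 80 * r * t
    H1 : ∀ c → c ∈ C → IsContrExpander G c m ε (T c)
    H2 : ∀ v c → v ∈ S → c ∈ C → ∣ T c ∣ ≤ 20 * r * degcB G c v (T c)
    H3 : ∀ v → v ∈ X →
         (2 * deg G v S ≤ ∣ S ∣) ⊎ (Σ (Fin r) λ c → c ∈ C × ∣ S ∣ ≤ 10 * r * degc G c v S)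

linkSet : ∀ {a n r} → Colouring a n r → Subset a → ℕ → Fin r → Subset n → Subset n → Subset a
linkSet {r = r} G X m c S S′ = tabulate (λ v →
  lookup X v ∧ ⌊ m ≤? 10 * r * degc G c v S ⌋ ∧ ⌊ m ≤? 10 * r * degc G c v S′ ⌋)

record LinkedHubFamily {a n r : ℕ} (G : Colouring a n r) (X : Subset a) (t m : ℕ) (ε : ℚ)
                       (ℓ : ℕ) : Set where
  field
    hub : Fin ℓ → Hub G X t m ε

  C : Fin ℓ → Subset r
  C i = Hub.C (hub i)
  S : Fin ℓ → Subset n
  S i = Hub.S (hub i)
  T : Fin ℓ → Fin r → Subset a
  T i = Hub.T (hub i)

  field
    cores-disjoint   : ∀ i j → i ≢ j → Empty (S i ∩ S j)
    routing-disjoint : ∀ i j → i ≢ j → ∀ c c′ → c ∈ C i → c′ ∈ C j →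
                       Empty (T i c ∩ T j c′)
    linked           : ∀ i j → i <ᶠ j → ∀ c →
                       ∣ linkSet G X m c (S i) (S j) ∣ ≡ 0 ⊎ t ≤ ∣ linkSet G X m c (S i) (S j) ∣

coreUnion : ∀ {a n r} {G : Colouring a n r} {X t m ε ℓ} → LinkedHubFamily G X t m ε ℓ → Subset n
coreUnion F = tabulate (λ w → anyF (λ i → lookup (LinkedHubFamily.S F i) w))

-- Simplified graph R(X,F): an (r+1)-edge-colouring E of pairs of vertices
-- of A ⊎ B, of which only the vertex set X ∪ ⋃ S_i matters.  Colour c ∈ [r]
-- is  inject₁ c , colour r+1 is  fromℕ r.  Any E meeting the specification
-- (i.e. any fixed choice of colours) is allowed.

Vtx : ℕ → ℕ → Set
Vtx a n = Fin a ⊎ Fin n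

module _ {a n r : ℕ} {G : Colouring a n r} {X : Subset a} {t m : ℕ} {ε : ℚ} {ℓ : ℕ}
         (F : LinkedHubFamily G X t m ε ℓ) where
  open LinkedHubFamily F using (C; S)
  open import Data.Sum using (inj₁; inj₂)

  inR : Vtx a n → Bool
  inR (inj₁ x) = lookup X x
  inR (inj₂ w) = lookup (coreUnion F) w

  record IsSimplifiedGraph (E : Vtx a n → Vtx a n → Maybe (Fin (suc r))) : Set where
    field
      symmetric : ∀ p q → E p q ≡ E q p
      X-indep   : ∀ x y → x ∈ X → y ∈ X → E (inj₁ x) (inj₁ y) ≡ nothing
      core-loop : ∀ w → w ∈ coreUnion F → E (inj₂ w) (inj₂ w) ≡ nothing
      core-comp : ∀ w w′ → w ∈ coreUnion F → w′ ∈ coreUnion F → w ≢ w′ →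
                  E (inj₂ w) (inj₂ w′) ≡ just (fromℕ r)
      low       : ∀ x i → x ∈ X → 2 * deg G x (S i) ≤ m →
                  ∀ w → w ∈ S i → E (inj₁ x) (inj₂ w) ≡ nothing
      high      : ∀ x i → x ∈ X → suc m ≤ 2 * deg G x (S i) →
                  Σ (Fin r) λ c → c ∈ C i × m ≤ 10 * r * degc G c x (S i) ×
                    (∀ w → w ∈ S i → E (inj₁ x) (inj₂ w) ≡ just (inject₁ c))

  sizeR : ℕ
  sizeR = ∣ X ∣ + ∣ coreUnion F ∣

  degR : (Vtx a n → Vtx a n → Maybe (Fin (suc r))) → Vtx a n → ℕ
  degR E v = ∣ tabulate (λ x → lookup X x ∧ is-just (E v (inj₁ x))) ∣
           + ∣ tabulate (λ w → lookup (coreUnion F) w ∧ is-just (E v (inj₂ w))) ∣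

module Submission where

-- Write U = ⋃ S_i. A core vertex is joined in R to all other core vertices, and |U| ≥ deg(x, U) ≥ (1 − δ)n
-- for any x ∈ X. A vertex x ∈ X is joined in R to every core except those with deg(x, S_i) ≤ m/2, and at
-- least half of each such core lies outside N_G(x); summing over the disjoint cores gives
-- 2 deg(x, U) ≤ deg_R(x) + |U|. In both cases what remains is a linear inequality in δ, n, |X| and |U|.

module Counting where

  open import Data.Bool.Base using (Bool; true; false; _∧_; _∨_; not)
  open import Data.Bool.Properties using (∧-distribʳ-∨)
  open import Data.Empty using (⊥; ⊥-elim)
  open import Data.Fin.Base using (Fin; zero; suc)
  open import Data.Fin.Properties using (suc-injective)
  open import Data.Fin.Subset using (Subset; ∣_∣; _∩_)
  open import Data.Nat.Base using (ℕ; zero; suc; _+_; _*_; _≤_; z≤n)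
  open import Data.Nat.Properties using (+-*-semiring; +-mono-≤; ≤-refl; ≤-trans; ≤-reflexive; module ≤-Reasoning)
  open import Algebra.Properties.Semiring.Sum +-*-semiring
    using (sum; sum-syntax; sum-cong-≗; sum-replicate-zero; ∑-distrib-+; *-distribˡ-sum)
  open import Data.Product.Base using (Σ; _,_)
  open import Data.Vec.Base using ([]; _∷_; lookup; tabulate)
  open import Data.Vec.Properties using (lookup∘tabulate; lookup-zipWith)
  open import Function.Base using (_∘_)
  open import Relation.Binary.PropositionalEquality
    using (_≡_; refl; sym; trans; cong; module ≡-Reasoning)

  open import Defs using (anyF)

  𝟙 : Bool → ℕ
  𝟙 true  = 1
  𝟙 false = 0

  𝟙-∧-≤ʳ : ∀ a b → 𝟙 (a ∧ b) ≤ 𝟙 b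
  𝟙-∧-≤ʳ true  b = ≤-refl
  𝟙-∧-≤ʳ false b = z≤n

  count : ∀ {k} → (Fin k → Bool) → ℕ
  count {k} f = ∑[ i < k ] 𝟙 (f i)

  Disjointᵇ : ∀ {k} → (Fin k → Bool) → (Fin k → Bool) → Set
  Disjointᵇ f g = ∀ w → f w ≡ true → g w ≡ true → ⊥

  ∧≡true⇒ˡ : ∀ {a b} → a ∧ b ≡ true → a ≡ true
  ∧≡true⇒ˡ {true} _ = refl

  ∧≡true⇒ʳ : ∀ {a b} → a ∧ b ≡ true → b ≡ true
  ∧≡true⇒ʳ {true} b = b

  ∑-mono-≤ : ∀ {k} {f g : Fin k → ℕ} → (∀ i → f i ≤ g i) → sum f ≤ sum g
  ∑-mono-≤ {zero}  _   = z≤n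
  ∑-mono-≤ {suc k} f≤g = +-mono-≤ (f≤g zero) (∑-mono-≤ (f≤g ∘ suc))

  count-cong : ∀ {k} {f g : Fin k → Bool} → (∀ w → f w ≡ g w) → count f ≡ count g
  count-cong {k} f≗g = sum-cong-≗ {k} (cong 𝟙 ∘ f≗g)

  count-false : ∀ {k} → count {k} (λ _ → false) ≡ 0
  count-false {k} = sum-replicate-zero k

  module _ {k} {f g h : Fin k → Bool} where

    count-≤-+ : (∀ w → 𝟙 (f w) ≤ 𝟙 (g w) + 𝟙 (h w)) → count f ≤ count g + count h
    count-≤-+ le = ≤-trans (∑-mono-≤ le) (≤-reflexive (∑-distrib-+ (𝟙 ∘ g) (𝟙 ∘ h)))

    count-+-≤ : (∀ w → 𝟙 (f w) + 𝟙 (g w) ≤ 𝟙 (h w)) → count f + count g ≤ count h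
    count-+-≤ le = ≤-trans (≤-reflexive (sym (∑-distrib-+ (𝟙 ∘ f) (𝟙 ∘ g)))) (∑-mono-≤ le)

  count-∨ : ∀ {k} {f g : Fin k → Bool} → Disjointᵇ f g →
            count (λ w → f w ∨ g w) ≡ count f + count g
  count-∨ {f = f} {g} f#g = trans (sum-cong-≗ pointwise) (∑-distrib-+ (𝟙 ∘ f) (𝟙 ∘ g))
    where
    pointwise : ∀ w → 𝟙 (f w ∨ g w) ≡ 𝟙 (f w) + 𝟙 (g w)
    pointwise w with f w in fw | g w in gw
    ... | true  | true  = ⊥-elim (f#g w fw gw)
    ... | true  | false = refl
    ... | false | _     = refl

  count-split : ∀ {k} (g f : Fin k → Bool) →
                count f ≡ count (λ w → g w ∧ f w) + count (λ w → f w ∧ not (g w))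
  count-split g f =
    trans (sum-cong-≗ pointwise) (∑-distrib-+ (λ w → 𝟙 (g w ∧ f w)) (λ w → 𝟙 (f w ∧ not (g w))))
    where
    pointwise : ∀ w → 𝟙 (f w) ≡ 𝟙 (g w ∧ f w) + 𝟙 (f w ∧ not (g w))
    pointwise w with g w | f w
    ... | true  | true  = refl
    ... | true  | false = refl
    ... | false | true  = refl
    ... | false | false = refl

  ∣p∣≡count : ∀ {k} (p : Subset k) → ∣ p ∣ ≡ count (lookup p)
  ∣p∣≡count []          = refl
  ∣p∣≡count (true ∷ p)  = cong suc (∣p∣≡count p)
  ∣p∣≡count (false ∷ p) = ∣p∣≡count p

  ∣tabulate∣≡count : ∀ {k} (f : Fin k → Bool) → ∣ tabulate f ∣ ≡ count f
  ∣tabulate∣≡count f = trans (∣p∣≡count (tabulate f)) (count-cong (lookup∘tabulate f))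

  ∣p∩q∣≡count : ∀ {k} (p q : Subset k) → ∣ p ∩ q ∣ ≡ count (λ w → lookup p w ∧ lookup q w)
  ∣p∩q∣≡count p q = trans (∣p∣≡count (p ∩ q)) (count-cong λ w → lookup-zipWith _∧_ w p q)

  anyF⁺ : ∀ {ℓ} (f : Fin ℓ → Bool) i → f i ≡ true → anyF f ≡ true
  anyF⁺ f zero    fi = cong (_∨ anyF (f ∘ suc)) fi
  anyF⁺ f (suc i) fi with f zero
  ... | true  = refl
  ... | false = anyF⁺ (f ∘ suc) i fi

  anyF⁻ : ∀ {ℓ} (f : Fin ℓ → Bool) → anyF f ≡ true → Σ (Fin ℓ) λ i → f i ≡ true
  anyF⁻ {suc ℓ} f any with f zero in f0
  ... | true  = zero , f0
  ... | false with anyF⁻ (f ∘ suc) any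
  ...   | i , fi = suc i , fi

  anyF-∧ʳ : ∀ {ℓ} (f : Fin ℓ → Bool) b → anyF (λ i → f i ∧ b) ≡ anyF f ∧ b
  anyF-∧ʳ {zero}  f b = refl
  anyF-∧ʳ {suc ℓ} f b = trans (cong (f zero ∧ b ∨_) (anyF-∧ʳ (f ∘ suc) b))
                              (sym (∧-distribʳ-∨ b (f zero) (anyF (f ∘ suc))))

  PairwiseDisjointᵇ : ∀ {k ℓ} → (Fin ℓ → Fin k → Bool) → Set
  PairwiseDisjointᵇ P = ∀ i j w → P i w ≡ true → P j w ≡ true → i ≡ j

  count-anyF : ∀ {k ℓ} (P : Fin ℓ → Fin k → Bool) → PairwiseDisjointᵇ P →
               count (λ w → anyF (λ i → P i w)) ≡ ∑[ i < ℓ ] count (P i)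
  count-anyF {k} {zero} P _ = count-false {k}
  count-anyF {ℓ = suc ℓ} P disjoint = begin
    count (λ w → P zero w ∨ anyF (λ i → P (suc i) w))
      ≡⟨ count-∨ P₀#rest ⟩
    count (P zero) + count (λ w → anyF (λ i → P (suc i) w))
      ≡⟨ cong (count (P zero) +_)
           (count-anyF (P ∘ suc) (λ i j w p q → suc-injective (disjoint (suc i) (suc j) w p q))) ⟩
    count (P zero) + ∑[ i < ℓ ] count (P (suc i)) ∎
    where
    open ≡-Reasoning
    P₀#rest : Disjointᵇ (P zero) (λ w → anyF (λ i → P (suc i) w))
    P₀#rest w p q with anyF⁻ (λ i → P (suc i) w) q
    ... | i , pᵢ with disjoint zero (suc i) w p pᵢ
    ... | ()

  count-anyF-half : ∀ {k ℓ} (P : Fin ℓ → Fin k → Bool) (h : Fin k → Bool) → PairwiseDisjointᵇ P →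
                    (∀ i → count (P i) ≤ 2 * count (λ w → P i w ∧ h w)) →
                    count (λ w → anyF (λ i → P i w)) ≤ 2 * count (λ w → anyF (λ i → P i w) ∧ h w)
  count-anyF-half {k} {ℓ} P h disjoint half = begin
    count (λ w → anyF (λ i → P i w))             ≡⟨ count-anyF P disjoint ⟩
    ∑[ i < ℓ ] count (P i)                       ≤⟨ ∑-mono-≤ half ⟩
    ∑[ i < ℓ ] (2 * count (Pʰ i))                ≡⟨ *-distribˡ-sum 2 (λ i → count (Pʰ i)) ⟨
    2 * (∑[ i < ℓ ] count (Pʰ i))                ≡⟨ cong (2 *_) (count-anyF Pʰ disjointʰ) ⟨
    2 * count (λ w → anyF (λ i → Pʰ i w))        ≡⟨ cong (2 *_) (count-cong λ w → anyF-∧ʳ (λ i → P i w) (h w)) ⟩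
    2 * count (λ w → anyF (λ i → P i w) ∧ h w)   ∎
    where
    open ≤-Reasoning
    Pʰ : Fin ℓ → Fin k → Bool
    Pʰ i w = P i w ∧ h w
    disjointʰ : PairwiseDisjointᵇ Pʰ
    disjointʰ i j w p q = disjoint i j w (∧≡true⇒ˡ p) (∧≡true⇒ˡ q)

module SimplifiedGraph where

  open Counting
  open import Defs
  open import Data.Bool.Base using (Bool; true; false; _∧_; not)
  open import Data.Empty using (⊥-elim)
  open import Data.Fin.Base using (Fin; suc)
  open import Data.Fin.Properties using () renaming (_≟_ to _≟ᶠ_)
  open import Data.Fin.Subset using (Subset; _∈_; ∣_∣; ⁅_⁆)
  open import Data.Fin.Subset.Properties using (x∈p∩q⁺; x∈⁅x⁆; ∣⁅x⁆∣≡1)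
  open import Data.Maybe.Base using (Maybe; is-just)
  open import Data.Nat.Base using (ℕ; suc; _+_; _*_; _≤_; s≤s; z≤n)
  open import Data.Nat.Properties
    using (_≤?_; ≤-refl; ≤-trans; ≤-reflexive; m≤n+m; +-mono-≤; +-monoˡ-≤; +-monoʳ-≤; +-identityʳ;
           +-cancelˡ-≤; ≰⇒>; module ≤-Reasoning)
  open import Data.Product.Base using (Σ; _,_)
  open import Data.Sum.Base using (inj₁; inj₂)
  open import Data.Vec.Base using (lookup)
  open import Data.Vec.Properties using (lookup∘tabulate; lookup⇒[]=; []=⇒lookup)
  open import Relation.Binary.PropositionalEquality using (_≡_; _≢_; refl; sym; trans; cong; subst; subst₂)
  open import Relation.Nullary.Decidable using (yes; no; ⌊_⌋)
  open import Relation.Nullary.Negation using (contradiction)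
  open import Data.Nat.Solver using (module +-*-Solver)
  open +-*-Solver using (solve; _:+_; _:*_; _:=_; con)
  open import Function.Base using (_∘_)

  2*m≤m+n⇒m+n≤2*n : ∀ {m n} → 2 * m ≤ m + n → m + n ≤ 2 * n
  2*m≤m+n⇒m+n≤2*n {m} {n} 2m≤m+n =
    subst (m + n ≤_) (cong (n +_) (sym (+-identityʳ n))) (+-monoˡ-≤ n m≤n)
    where
    m≤n : m ≤ n
    m≤n = +-cancelˡ-≤ m m n (subst (_≤ m + n) (cong (m +_) (+-identityʳ m)) 2m≤m+n)

  double-count : ∀ {u D c L d} → u ≤ D + c → c ≤ 2 * L → L + d ≤ u → d + d ≤ D + u
  double-count {u} {D} {c} {L} {d} u≤D+c c≤2L L+d≤u =
    +-cancelˡ-≤ (2 * L) (d + d) (D + u) (begin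
    2 * L + (d + d)    ≡⟨ solve 2 (λ L d → con 2 :* L :+ (d :+ d) := (L :+ d) :+ (L :+ d)) refl L d ⟩
    (L + d) + (L + d)  ≤⟨ +-mono-≤ L+d≤u L+d≤u ⟩
    u + u              ≤⟨ +-monoˡ-≤ u (≤-trans u≤D+c (+-monoʳ-≤ D c≤2L)) ⟩
    D + 2 * L + u      ≡⟨ solve 3 (λ D L u → D :+ con 2 :* L :+ u := con 2 :* L :+ (D :+ u)) refl D L u ⟩
    2 * L + (D + u)    ∎)
    where open ≤-Reasoning

  lookup⁅y⁆x≡false⇒y≢x : ∀ {k} {x y : Fin k} → lookup ⁅ y ⁆ x ≡ false → y ≢ x
  lookup⁅y⁆x≡false⇒y≢x {x = x} x∉⁅x⁆ refl with () ← trans (sym ([]=⇒lookup (x∈⁅x⁆ x))) x∉⁅x⁆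

  module SimplifiedGraphDegree
    {a n r t m ℓ ε} {G : Colouring a n r} {X : Subset a}
    (F : LinkedHubFamily G X t m ε ℓ)
    {E : Vtx a n → Vtx a n → Maybe (Fin (suc r))} (R : IsSimplifiedGraph F E) where

    open LinkedHubFamily F using (S; hub; cores-disjoint)
    open IsSimplifiedGraph R

    inCores : Fin n → Bool
    inCores = lookup (coreUnion F)

    inCores⁺ : ∀ {i w} → w ∈ S i → inCores w ≡ true
    inCores⁺ {i} {w} w∈Sᵢ =
      trans (lookup∘tabulate _ w) (anyF⁺ (λ j → lookup (S j) w) i ([]=⇒lookup w∈Sᵢ))

    inCores⁻ : ∀ {w} → inCores w ≡ true → Σ (Fin ℓ) λ i → w ∈ S i
    inCores⁻ {w} w∈⋃S with anyF⁻ (λ j → lookup (S j) w) (trans (sym (lookup∘tabulate _ w)) w∈⋃S)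
    ... | i , w∈Sᵢ = i , lookup⇒[]= w (S i) w∈Sᵢ

    coreNeighbour : Vtx a n → Fin n → Bool
    coreNeighbour v w = inCores w ∧ is-just (E v (inj₂ w))

    count-coreNeighbour≤degR : ∀ v → count (coreNeighbour v) ≤ degR F E v
    count-coreNeighbour≤degR v =
      subst (_≤ degR F E v) (∣tabulate∣≡count (coreNeighbour v)) (m≤n+m _ _)

    ∣⋃S∣≤degR+1 : ∀ {w₀} → w₀ ∈ coreUnion F → ∣ coreUnion F ∣ ≤ degR F E (inj₂ w₀) + 1
    ∣⋃S∣≤degR+1 {w₀} w₀∈⋃S = begin
      ∣ coreUnion F ∣                                 ≡⟨ ∣p∣≡count (coreUnion F) ⟩
      count inCores                                   ≤⟨ count-≤-+ pointwise ⟩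
      count (coreNeighbour (inj₂ w₀)) + count (lookup ⁅ w₀ ⁆)
        ≤⟨ +-mono-≤ (count-coreNeighbour≤degR (inj₂ w₀))
                    (≤-reflexive (trans (sym (∣p∣≡count ⁅ w₀ ⁆)) (∣⁅x⁆∣≡1 w₀))) ⟩
      degR F E (inj₂ w₀) + 1                          ∎
      where
      open ≤-Reasoning
      pointwise : ∀ w → 𝟙 (inCores w) ≤ 𝟙 (coreNeighbour (inj₂ w₀) w) + 𝟙 (lookup ⁅ w₀ ⁆ w)
      pointwise w with inCores w in w∈⋃S | lookup ⁅ w₀ ⁆ w in w∈⁅w₀⁆
      ... | false | _    = z≤n
      ... | true  | true = m≤n+m _ _
      ... | true  | false
        rewrite core-comp w₀ w w₀∈⋃S (lookup⇒[]= w _ w∈⋃S)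
                  (lookup⁅y⁆x≡false⇒y≢x w∈⁅w₀⁆) = ≤-refl

    deg≡count : ∀ x Q → deg G x Q ≡ count (λ w → is-just (G x w) ∧ lookup Q w)
    deg≡count x Q = trans (∣p∩q∣≡count (nbrB G x) Q)
      (count-cong λ w → cong (_∧ lookup Q w) (lookup∘tabulate _ w))

    module _ {x : Fin a} (x∈X : x ∈ X) where

      isGNeighbour : Fin n → Bool
      isGNeighbour w = is-just (G x w)

      isLow : Fin ℓ → Bool
      isLow i = ⌊ 2 * deg G x (S i) ≤? m ⌋

      lowCore : Fin ℓ → Fin n → Bool
      lowCore i w = isLow i ∧ lookup (S i) w

      lowCore⁺ : ∀ {i w} → 2 * deg G x (S i) ≤ m → w ∈ S i → lowCore i w ≡ true
      lowCore⁺ {i} low w∈Sᵢ with 2 * deg G x (S i) ≤? m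
      ... | yes _   = []=⇒lookup w∈Sᵢ
      ... | no ¬low = contradiction low ¬low

      inLowCores : Fin n → Bool
      inLowCores w = anyF (λ i → lowCore i w)

      outsideLowCores : Fin n → Bool
      outsideLowCores w = inLowCores w ∧ not (isGNeighbour w)

      ∣⋃S∣≤degR+inLowCores : ∣ coreUnion F ∣ ≤ degR F E (inj₁ x) + count inLowCores
      ∣⋃S∣≤degR+inLowCores = begin
        ∣ coreUnion F ∣                                  ≡⟨ ∣p∣≡count (coreUnion F) ⟩
        count inCores                                    ≤⟨ count-≤-+ pointwise ⟩
        count (coreNeighbour (inj₁ x)) + count inLowCores ≤⟨ +-monoˡ-≤ _ (count-coreNeighbour≤degR (inj₁ x)) ⟩
        degR F E (inj₁ x) + count inLowCores             ∎
        where
        open ≤-Reasoning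
        pointwise : ∀ w → 𝟙 (inCores w) ≤ 𝟙 (coreNeighbour (inj₁ x) w) + 𝟙 (inLowCores w)
        pointwise w with inCores w in w∈⋃S | is-just (E (inj₁ x) (inj₂ w)) in xw∈R
        ... | false | _    = z≤n
        ... | true  | true = s≤s z≤n
        ... | true  | false with inCores⁻ w∈⋃S
        ...   | i , w∈Sᵢ with 2 * deg G x (S i) ≤? m
        ...     | yes low
          rewrite anyF⁺ (λ j → lowCore j w) i (lowCore⁺ low w∈Sᵢ) = ≤-refl
        ...     | no ¬low with high x i x∈X (≰⇒> ¬low)
        ...       | _ , _ , _ , xSᵢ∈R with () ← trans (sym xw∈R) (cong is-just (xSᵢ∈R w w∈Sᵢ))

      lowCores-disjoint : PairwiseDisjointᵇ lowCore
      lowCores-disjoint i j w w∈Sᵢ w∈Sⱼ with i ≟ᶠ j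
      ... | yes i≡j = i≡j
      ... | no  i≢j = ⊥-elim (cores-disjoint i j i≢j
              (w , x∈p∩q⁺ (lookup⇒[]= w _ (∧≡true⇒ʳ w∈Sᵢ) , lookup⇒[]= w _ (∧≡true⇒ʳ w∈Sⱼ))))

      ∣Sᵢ∣≤2*outside : ∀ i → 2 * deg G x (S i) ≤ m →
                       count (lookup (S i)) ≤ 2 * count (λ w → lookup (S i) w ∧ not (isGNeighbour w))
      ∣Sᵢ∣≤2*outside i low =
        subst (_≤ 2 * outside) (sym split)
          (2*m≤m+n⇒m+n≤2*n {inside} {outside} (subst (2 * inside ≤_) split 2*inside≤∣Sᵢ∣))
        where
        inside outside : ℕ
        inside  = count (λ w → isGNeighbour w ∧ lookup (S i) w)
        outside = count (λ w → lookup (S i) w ∧ not (isGNeighbour w))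
        split : count (lookup (S i)) ≡ inside + outside
        split = count-split isGNeighbour (lookup (S i))
        2*inside≤∣Sᵢ∣ : 2 * inside ≤ count (lookup (S i))
        2*inside≤∣Sᵢ∣ = subst₂ (λ d s → 2 * d ≤ s)
          (deg≡count x (S i)) (trans (sym (Hub.core-size (hub i))) (∣p∣≡count (S i))) low

      lowCore-half-outside : ∀ i → count (λ w → isLow i ∧ lookup (S i) w) ≤
                                   2 * count (λ w → (isLow i ∧ lookup (S i) w) ∧ not (isGNeighbour w))
      lowCore-half-outside i with 2 * deg G x (S i) ≤? m
      ... | yes low = ∣Sᵢ∣≤2*outside i low
      ... | no _    = ≤-trans (≤-reflexive (count-false {n})) z≤n

      inLowCores≤2*outside : count inLowCores ≤ 2 * count outsideLowCores
      inLowCores≤2*outside =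
        count-anyF-half lowCore (not ∘ isGNeighbour) lowCores-disjoint lowCore-half-outside

      outside+deg≤∣⋃S∣ : count outsideLowCores + deg G x (coreUnion F) ≤ ∣ coreUnion F ∣
      outside+deg≤∣⋃S∣ = subst₂ (λ d u → count outsideLowCores + d ≤ u)
        (sym (deg≡count x (coreUnion F))) (sym (∣p∣≡count (coreUnion F)))
        (count-+-≤ {f = outsideLowCores} pointwise)
        where
        pointwise : ∀ w → 𝟙 (outsideLowCores w) + 𝟙 (isGNeighbour w ∧ inCores w) ≤ 𝟙 (inCores w)
        pointwise w with inLowCores w in w∈L
        ... | false = 𝟙-∧-≤ʳ (isGNeighbour w) (inCores w)
        ... | true with anyF⁻ (λ i → lowCore i w) w∈L
        ...   | i , w∈Sᵢ rewrite inCores⁺ (lookup⇒[]= w (S i) (∧≡true⇒ʳ w∈Sᵢ)) with isGNeighbour w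
        ...     | true  = ≤-refl
        ...     | false = ≤-refl

      deg+deg≤degR+∣⋃S∣ : deg G x (coreUnion F) + deg G x (coreUnion F) ≤ degR F E (inj₁ x) + ∣ coreUnion F ∣
      deg+deg≤degR+∣⋃S∣ = double-count {c = count inLowCores} {L = count outsideLowCores}
        ∣⋃S∣≤degR+inLowCores inLowCores≤2*outside outside+deg≤∣⋃S∣

module RationalBounds where

  open import Data.Empty using (⊥-elim)
  open import Data.Integer.Base as ℤ using (+_)
  import Data.Integer.Properties as ℤ
  open import Data.Nat.Base as ℕ using (ℕ)
  open import Data.Nat.Coprimality using (1-coprimeTo) renaming (sym to coprime-sym)
  open import Data.Rational.Base
  open import Data.Rational.Properties
  open import Data.Rational.Solver using (module +-*-Solver)
  open import Data.Sum.Base using (inj₁; inj₂)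
  open import Relation.Nullary.Negation using (¬_)
  open import Relation.Binary.PropositionalEquality
    using (_≡_; refl; sym; trans; cong; cong₂; subst; subst₂)

  open import Defs using (ℕq)

  open +-*-Solver

  ℕq≡mkℚ : ∀ k → ℕq k ≡ mkℚ (+ k) 0 (coprime-sym (1-coprimeTo k))
  ℕq≡mkℚ k = normalize-coprime (coprime-sym (1-coprimeTo k))

  ℕq-+ : ∀ j k → ℕq (j ℕ.+ k) ≡ ℕq j + ℕq k
  ℕq-+ j k rewrite ℕq≡mkℚ j | ℕq≡mkℚ k =
    cong (_/ 1) (sym (cong₂ ℤ._+_ (ℤ.*-identityʳ (+ j)) (ℤ.*-identityʳ (+ k))))

  ℕq-mono-≤ : ∀ {j k} → j ℕ.≤ k → ℕq j ≤ ℕq k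
  ℕq-mono-≤ {j} {k} j≤k rewrite ℕq≡mkℚ j | ℕq≡mkℚ k =
    *≤* (subst₂ ℤ._≤_ (sym (ℤ.*-identityʳ (+ j))) (sym (ℤ.*-identityʳ (+ k))) (ℤ.+≤+ j≤k))

  0≤ℕq : ∀ k → 0ℚ ≤ ℕq k
  0≤ℕq k = ℕq-mono-≤ (ℕ.z≤n {k})

  p≤q⇒0≤q-p : ∀ {p q} → p ≤ q → 0ℚ ≤ q - p
  p≤q⇒0≤q-p {p} {q} p≤q = subst (_≤ q - p) (+-inverseʳ p) (+-monoˡ-≤ (- p) p≤q)

  0≤p*q : ∀ {p q} → 0ℚ ≤ p → 0ℚ ≤ q → 0ℚ ≤ p * q
  0≤p*q {p} {q} 0≤p 0≤q = subst (_≤ p * q) (*-zeroʳ p) (*-monoˡ-≤-nonNeg p {{nonNegative 0≤p}} 0≤q)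

  ≤-by-certificate : ∀ {p q c} → 0ℚ ≤ c → q - p ≡ c → p ≤ q
  ≤-by-certificate {p} {q} 0≤c q-p≡c =
    subst₂ _≤_ (+-identityˡ p) (trans (cong (_+ p) (sym q-p≡c)) (cancel p q)) (+-monoˡ-≤ p 0≤c)
    where
    cancel : ∀ p q → (q - p) + p ≡ q
    cancel = solve 2 (λ p q → (q :- p) :+ p := q) refl

  1≤p*ℕq⇒0≤p : ∀ p k → 1ℚ ≤ p * ℕq k → 0ℚ ≤ p
  1≤p*ℕq⇒0≤p p k 1≤pk with ≤-total 0ℚ p
  ... | inj₁ 0≤p = 0≤p
  ... | inj₂ p≤0 = ⊥-elim (0≰-1 (subst (0ℚ ≤_) (identity p (ℕq k))
                              (+-mono-≤ (0≤p*q (p≤q⇒0≤q-p p≤0) (0≤ℕq k)) (p≤q⇒0≤q-p 1≤pk))))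
    where
    0≰-1 : ¬ 0ℚ ≤ - 1ℚ
    0≰-1 (*≤* ())
    identity : ∀ p K → (0ℚ - p) * K + (p * K - 1ℚ) ≡ - 1ℚ
    identity = solve 2 (λ p K → (con 0ℚ :- p) :* K :+ (p :* K :- con 1ℚ) := :- con 1ℚ) refl

  -- In both bounds below the slack is an explicit nonnegative combination of the hypotheses,
  -- and the ring solver verifies the identity.
  bound-at-X-vertex : ∀ (δ : ℚ) (n u x D d : ℕ) → 1ℚ ≤ δ * ℕq n → ℕq x ≤ δ * ℕq n →
                      (1ℚ - δ) * ℕq n ≤ ℕq d → d ℕ.+ d ℕ.≤ D ℕ.+ u → u ℕ.≤ n →
                      (1ℚ - ℕq 6 * δ) * ℕq (x ℕ.+ u) ≤ ℕq D
  bound-at-X-vertex δ n u x D d 1≤δn x≤δn d-lower 2d≤D+u u≤n rewrite ℕq-+ x u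
    with ≤-total 0ℚ (1ℚ - ℕq 6 * δ)
  ... | inj₂ k≤0 = ≤-by-certificate (+-mono-≤ (0≤ℕq D) (0≤p*q (p≤q⇒0≤q-p k≤0) (+-mono-≤ (0≤ℕq x) (0≤ℕq u))))
                     (identity δ (ℕq D) (ℕq x) (ℕq u))
    where
    identity : ∀ δ D x u → D - (1ℚ - ℕq 6 * δ) * (x + u) ≡ D + (0ℚ - (1ℚ - ℕq 6 * δ)) * (x + u)
    identity = solve 4 (λ δ D x u → D :- (con 1ℚ :- con (ℕq 6) :* δ) :* (x :+ u)
                                 := D :+ (con 0ℚ :- (con 1ℚ :- con (ℕq 6) :* δ)) :* (x :+ u)) refl
  ... | inj₁ 0≤k = ≤-by-certificate
    (+-mono-≤ (+-mono-≤ (+-mono-≤ (+-mono-≤ (+-mono-≤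
      (p≤q⇒0≤q-p (subst₂ _≤_ (ℕq-+ d d) (ℕq-+ D u) (ℕq-mono-≤ 2d≤D+u)))
      (0≤p*q (0≤ℕq 2) (p≤q⇒0≤q-p d-lower)))
      (p≤q⇒0≤q-p x≤δn))
      (0≤p*q (0≤ℕq 3) (0≤p*q 0≤δ (0≤ℕq n))))
      (0≤p*q (p≤q⇒0≤q-p (ℕq-mono-≤ u≤n)) (+-mono-≤ 0≤k (0≤ℕq 1))))
      (0≤p*q (0≤p*q (0≤ℕq 6) 0≤δ) (0≤ℕq x)))
    (identity δ (ℕq n) (ℕq u) (ℕq x) (ℕq D) (ℕq d))
    where
    0≤δ : 0ℚ ≤ δ
    0≤δ = 1≤p*ℕq⇒0≤p δ n 1≤δn
    identity : ∀ δ N u x D d → D - (1ℚ - ℕq 6 * δ) * (x + u) ≡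
               ((D + u) - (d + d)) + ℕq 2 * (d - (1ℚ - δ) * N) + (δ * N - x) + ℕq 3 * (δ * N)
               + (N - u) * ((1ℚ - ℕq 6 * δ) + 1ℚ) + ℕq 6 * δ * x
    identity = solve 6 (λ δ N u x D d → D :- (con 1ℚ :- con (ℕq 6) :* δ) :* (x :+ u) :=
               ((D :+ u) :- (d :+ d)) :+ con (ℕq 2) :* (d :- (con 1ℚ :- δ) :* N) :+ (δ :* N :- x)
               :+ con (ℕq 3) :* (δ :* N) :+ (N :- u) :* ((con 1ℚ :- con (ℕq 6) :* δ) :+ con 1ℚ)
               :+ con (ℕq 6) :* δ :* x) refl

  bound-at-core-vertex : ∀ (δ : ℚ) (n u x D d : ℕ) → 1ℚ ≤ δ * ℕq n → δ ≤ + 1 / 2 → ℕq x ≤ δ * ℕq n →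
                         (1ℚ - δ) * ℕq n ≤ ℕq d → d ℕ.≤ u → u ℕ.≤ D ℕ.+ 1 →
                         (1ℚ - ℕq 6 * δ) * ℕq (x ℕ.+ u) ≤ ℕq D
  bound-at-core-vertex δ n u x D d 1≤δn δ≤½ x≤δn d-lower d≤u u≤D+1 rewrite ℕq-+ x u = ≤-by-certificate
    (+-mono-≤ (+-mono-≤ (+-mono-≤ (+-mono-≤ (+-mono-≤
      (p≤q⇒0≤q-p (subst (ℕq u ≤_) (ℕq-+ D 1) (ℕq-mono-≤ u≤D+1)))
      (0≤p*q (0≤p*q (0≤ℕq 6) 0≤δ) (+-mono-≤ (p≤q⇒0≤q-p (ℕq-mono-≤ d≤u)) (p≤q⇒0≤q-p d-lower))))
      (p≤q⇒0≤q-p 1≤δn))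
      (p≤q⇒0≤q-p x≤δn))
      (0≤p*q (0≤p*q 0≤δ (0≤ℕq n)) (+-mono-≤ (0≤ℕq 1) (0≤p*q (0≤ℕq 6) (p≤q⇒0≤q-p δ≤½)))))
      (0≤p*q (0≤p*q (0≤ℕq 6) 0≤δ) (0≤ℕq x)))
    (identity δ (ℕq n) (ℕq u) (ℕq x) (ℕq D) (ℕq d))
    where
    0≤δ : 0ℚ ≤ δ
    0≤δ = 1≤p*ℕq⇒0≤p δ n 1≤δn
    identity : ∀ δ N u x D d → D - (1ℚ - ℕq 6 * δ) * (x + u) ≡
               ((D + 1ℚ) - u) + ℕq 6 * δ * ((u - d) + (d - (1ℚ - δ) * N)) + (δ * N - 1ℚ) + (δ * N - x)
               + (δ * N) * (1ℚ + ℕq 6 * (+ 1 / 2 - δ)) + ℕq 6 * δ * x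
    identity = solve 6 (λ δ N u x D d → D :- (con 1ℚ :- con (ℕq 6) :* δ) :* (x :+ u) :=
               ((D :+ con 1ℚ) :- u) :+ con (ℕq 6) :* δ :* ((u :- d) :+ (d :- (con 1ℚ :- δ) :* N))
               :+ (δ :* N :- con 1ℚ) :+ (δ :* N :- x)
               :+ (δ :* N) :* (con 1ℚ :+ con (ℕq 6) :* (con (+ 1 / 2) :- δ)) :+ con (ℕq 6) :* δ :* x) refl

open import Defs
open import Data.Nat using (ℕ; suc; _≤_)
open import Data.Fin using (Fin)
open import Data.Fin.Subset using (Subset; _∈_; ∣_∣; Nonempty)
open import Data.Maybe using (Maybe)
open import Data.Bool using (true)
open import Relation.Binary.PropositionalEquality using (_≡_)
open import Data.Integer using (+_)
open import Data.Rational using (ℚ; 0ℚ; 1ℚ; _/_) renaming (_<_ to _<q_; _≤_ to _≤q_; _*_ to _*q_; _-_ to _-q_)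

open import Data.Fin.Subset.Properties using (∣p∣≤n; ∣p∩q∣≤∣q∣)
open import Data.Product.Base using (_,_)
open import Data.Sum.Base using (inj₁; inj₂)
open import Data.Vec.Properties using (lookup⇒[]=)

open SimplifiedGraph using (module SimplifiedGraphDegree)
open RationalBounds using (bound-at-X-vertex; bound-at-core-vertex)

lemma4p10 :
    ∀ (n m r t : ℕ) → 2 ≤ n → 2 ≤ m → 2 ≤ r → 2 ≤ t →
    (δ : ℚ) → 1ℚ ≤q δ *q ℕq n → δ ≤q + 1 / 2 →
    (ε : ℚ) → 0ℚ <q ε →
    (a : ℕ) (G : Colouring a n r) →
    (X : Subset a) → Nonempty X → ℕq ∣ X ∣ ≤q δ *q ℕq n →
    (ℓ : ℕ) (F : LinkedHubFamily G X t m ε ℓ) →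
    (∀ v → v ∈ X → (1ℚ -q δ) *q ℕq n ≤q ℕq (deg G v (coreUnion F))) →
    (E : Vtx a n → Vtx a n → Maybe (Fin (suc r))) → IsSimplifiedGraph F E →
    ∀ v → inR F v ≡ true →
    (1ℚ -q (ℕq 6 *q δ)) *q ℕq (sizeR F) ≤q ℕq (degR F E v)
lemma4p10 n _ _ _ _ _ _ _ δ 1≤δn _ _ _ _ G X _ ∣X∣≤δn _ F deg-lower E R (inj₁ x) x∈R =
  bound-at-X-vertex δ n ∣ coreUnion F ∣ ∣ X ∣ (degR F E (inj₁ x)) (deg G x (coreUnion F))
    1≤δn ∣X∣≤δn (deg-lower x x∈X) (deg+deg≤degR+∣⋃S∣ x∈X) (∣p∣≤n (coreUnion F))
  where
  open SimplifiedGraphDegree F R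
  x∈X : x ∈ X
  x∈X = lookup⇒[]= x X x∈R
lemma4p10 n _ _ _ _ _ _ _ δ 1≤δn δ≤½ _ _ _ G X (x₀ , x₀∈X) ∣X∣≤δn _ F deg-lower E R (inj₂ w) w∈R =
  bound-at-core-vertex δ n ∣ coreUnion F ∣ ∣ X ∣ (degR F E (inj₂ w)) (deg G x₀ (coreUnion F))
    1≤δn δ≤½ ∣X∣≤δn (deg-lower x₀ x₀∈X) (∣p∩q∣≤∣q∣ (nbrB G x₀) (coreUnion F))
    (∣⋃S∣≤degR+1 (lookup⇒[]= w (coreUnion F) w∈R))
  where open SimplifiedGraphDegree F R
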